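{- Let $k\ge 1$, let $\mathbf{r}=(r_0,\ldots,r_{k-1})$ be a $k$-tuple of positive integers and $h$ an integer with $1\le h\le\sum_{j=0}^{k-1}r_j$. Let $X_1\rightarrow X_2\rightarrow\cdots\rightarrow X_{t-1}\rightarrow X_t$ and $X_1\rightarrow X_2'\rightarrow\cdots\rightarrow X_{t-1}'\rightarrow X_t$ be two different $(\mathbf{r},h)$-paths from $X_1$ to $X_t$. If $A=\{a_0<a_1<\cdots<a_{k-1}\}$ is a set of $k$ integers such that $|h^{(\mathbf{r})}A|=L(\mathbf{r},h)$, then $\phi_A(X_i)=\phi_A(X_i')$ for $i=2,3,\ldots,t-1$.
   Context: $\mathbb{N}$ denotes the nonnegative integers. $R(\mathbf{r},h)$ is the set of all $(x_0,\ldots,x_{k-1})\in\mathbb{N}^k$ with $\sum_{j}x_j=h$ and $0\le x_i\le r_i$ for all $i$. For $X=(x_0,\ldots,x_{k-1})\in\mathbb{N}^k$, $\phi_A(X)=\sum_{j=0}^{k-1}x_ja_j$. For $U,W\in\mathbb{N}^k$, $U\rightarrow W$ is a step if there is $j$ with $0\le j\le k-2$, $w_j=u_j-1$, $w_{j+1}=u_{j+1}+1$, and $w_i=u_i$ for $i\ne j,j+1$. A sequence $X_1\rightarrow\cdots\rightarrow X_t$ is an $(\mathbf{r},h)$-path of length $t$ if all $X_i\in R(\mathbf{r},h)$ and each $X_i\rightarrow X_{i+1}$ is a step. The sumset is $h^{(\mathbf{r})}A=\{\phi_A(X):X\in R(\mathbf{r},h)\}$. Empty sums are $0$. Let $I_{\mathbf{r}}(h)$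 be the largest integer (with $0\le I_{\mathbf{r}}(h)\le k$) such that $\sum_{j=0}^{I_{\mathbf{r}}(h)-1}r_j\le h$, $M_{\mathbf{r}}(h)$ the least integer (with $-1\le M_{\mathbf{r}}(h)\le k-1$) such that $\sum_{j=M_{\mathbf{r}}(h)+1}^{k-1}r_j\le h$, $\delta_{\mathbf{r}}(h)=h-\sum_{j=0}^{I_{\mathbf{r}}(h)-1}r_j$, $\theta_{\mathbf{r}}(h)=h-\sum_{j=M_{\mathbf{r}}(h)+1}^{k-1}r_j$, and $$L(\mathbf{r},h)=\sum_{j=M_{\mathbf{r}}(h)+1}^{k-1}j r_j-\sum_{j=0}^{I_{\mathbf{r}}(h)-1}j r_j+M_{\mathbf{r}}(h)\,\theta_{\mathbf{r}}(h)-I_{\mathbf{r}}(h)\,\delta_{\mathbf{r}}(h)+1.$$ -}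

module Defs where

open import Data.Nat using (ℕ; zero; suc; _+_; _*_; _∸_; _≤_; _<_; _≤?_)
open import Data.Bool using (Bool; true; false; if_then_else_)
open import Data.Integer as ℤ using (ℤ; +_)
open import Data.Fin using (Fin)
open import Data.Vec using (Vec; []; _∷_; lookup)
open import Data.List using (List; length)
open import Data.List.Membership.Propositional using (_∈_)
open import Data.List.Relation.Unary.Unique.Propositional using (Unique)
open import Data.Product using (Σ; ∃; _×_; _,_)
open import Function.Bundles using (_⇔_)
open import Relation.Nullary.Decidable using (⌊_⌋)
open import Relation.Binary.PropositionalEquality using (_≡_; _≢_)

-- r_j as a function of j ∈ ℕ (value 0 outside the range 0..k-1)
at : ∀ {k} → Vec ℕ k → ℕ → ℕ
at []       _       = 0
at (x ∷ xs) zero    = x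
at (x ∷ xs) (suc j) = at xs j

sumFrom : (ℕ → ℕ) → ℕ → ℕ → ℕ
sumFrom f a zero    = 0
sumFrom f a (suc n) = f a + sumFrom f (suc a) n

sumRange : (ℕ → ℕ) → ℕ → ℕ → ℕ
sumRange f a b = sumFrom f a (b ∸ a)

-- largest i ≤ n with P i (0 if none)
largestUpTo : ℕ → (ℕ → Bool) → ℕ
largestUpTo zero    P = 0
largestUpTo (suc n) P = if P (suc n) then suc n else largestUpTo n P

-- least i ≤ n with P i (n if none)
leastUpTo : ℕ → (ℕ → Bool) → ℕ
leastUpTo zero    P = 0
leastUpTo (suc n) P = if P 0 then 0 else suc (leastUpTo n (λ i → P (suc i)))

module _ {k : ℕ} (r : Vec ℕ k) (h : ℕ) where

  Ir : ℕ
  Ir = largestUpTo k (λ i → ⌊ sumRange (at r) 0 i ≤? h ⌋)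

  Mr+1 : ℕ
  Mr+1 = leastUpTo k (λ m → ⌊ sumRange (at r) m k ≤? h ⌋)

  -- M_r(h) ∈ [-1, k-1]
  Mr : ℤ
  Mr = + Mr+1 ℤ.- + 1

  δr : ℕ
  δr = h ∸ sumRange (at r) 0 Ir

  θr : ℕ
  θr = h ∸ sumRange (at r) Mr+1 k

  L : ℤ
  L = + sumRange (λ j → j * at r j) Mr+1 k
      ℤ.- + sumRange (λ j → j * at r j) 0 Ir
      ℤ.+ Mr ℤ.* + θr
      ℤ.- + (Ir * δr)
      ℤ.+ + 1

InR : ∀ {k} → Vec ℕ k → ℕ → Vec ℕ k → Set
InR {k} r h X = (Data.Vec.sum X ≡ h) × (∀ (i : Fin k) → lookup X i ≤ lookup r i)

φ : ∀ {k} → Vec ℤ k → Vec ℕ k → ℤ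
φ []       []       = + 0
φ (a ∷ as) (x ∷ xs) = + x ℤ.* a ℤ.+ φ as xs

Step : ∀ {k} → Vec ℕ k → Vec ℕ k → Set
Step {k} U W = Σ ℕ λ j → (suc j < k)
  × (at W j + 1 ≡ at U j)
  × (at W (suc j) ≡ at U (suc j) + 1)
  × (∀ i → i < k → i ≢ j → i ≢ suc j → at W i ≡ at U i)

-- an (r,h)-path X_1 → ... → X_t, given as P 1, ..., P t
IsPath : ∀ {k} → Vec ℕ k → ℕ → ℕ → (ℕ → Vec ℕ k) → Set
IsPath r h t P = (∀ i → 1 ≤ i → i ≤ t → InR r h (P i))
               × (∀ i → 1 ≤ i → i < t → Step (P i) (P (suc i)))

InSumset : ∀ {k} → Vec ℕ k → ℕ → Vec ℤ k → ℤ → Set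
InSumset {k} r h a z = Σ (Vec ℕ k) λ X → InR r h X × (φ a X ≡ z)

HasCard : (ℤ → Set) → ℕ → Set
HasCard P n = Σ (List ℤ) λ l → Unique l × (∀ z → (z ∈ l) ⇔ P z) × (length l ≡ n)

{-# OPTIONS --safe #-}
-- The weight w(X) = Σ j x_j rises by exactly one along every step, so two (r,h)-paths with
-- the same start have equal weights at every index. Any X ∈ R(r,h) other than the
-- left-packed vector admits a step Y → X inside R(r,h), which lowers w by one and φ_A
-- strictly; descending this way gives w(X) − w_min + 1 distinct sums ≤ φ_A(X). Dually,
-- ascending to the right-packed vector gives w_max − w(Y) + 1 distinct sums ≥ φ_A(Y).
-- Since L(r,h) = w_max − w_min + 1, equal weights and φ_A(X) < φ_A(Y) would yield
-- L(r,h) + 1 elements of h^(r)A.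
module Submission where

open import Defs
open import Data.Bool using (Bool; true; false; if_then_else_)
open import Data.Bool.Properties using (T-≡)
open import Data.Empty using (⊥-elim)
open import Data.Fin as Fin using (Fin; zero; suc)
open import Data.Fin.Properties using (injective⇒≤)
open import Data.Integer as ℤ using (ℤ; +_)
import Data.Integer.Properties as ℤₚ
import Data.Integer.Tactic.RingSolver as ℤ-Ring
open import Data.List as List using (List; []; _∷_; length; _++_)
open import Data.List.Membership.Propositional using (_∈_)
open import Data.List.Membership.Propositional.Properties using (∈-lookup)
open import Data.List.Properties using (length-++)
open import Data.List.Relation.Binary.Subset.Propositional using (_⊆_)
open import Data.List.Relation.Unary.All as All using (All; []; _∷_)
import Data.List.Relation.Unary.All.Properties as All
open import Data.List.Relation.Unary.AllPairs using ([]; _∷_)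
open import Data.List.Relation.Unary.Any using (index)
open import Data.List.Relation.Unary.Any.Properties using (lookup-index)
open import Data.List.Relation.Unary.Unique.Propositional using (Unique)
import Data.List.Relation.Unary.Unique.Propositional.Properties as Unique
open import Data.Nat using (ℕ; zero; suc; _+_; _*_; _∸_; _≤_; _<_; z≤n; s≤s; z<s; s<s; _≤?_)
open import Data.Nat.Properties
open import Algebra.Properties.CommutativeSemigroup +-commutativeSemigroup using (interchange; xy∙z≈xz∙y)
open import Data.Product using (Σ; ∃; ∃₂; _×_; _,_; proj₁)
open import Data.Sum using (_⊎_; inj₁; inj₂; map₂)
open import Data.Vec using (Vec; []; _∷_; lookup; sum; replicate)
open import Function using (_∘_; flip)
open import Function.Bundles using (Equivalence; _⇔_; mk⇔)
open import Relation.Binary.Definitions using (Transitive)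
open import Relation.Binary.PropositionalEquality
open import Relation.Nullary using (¬_; Dec; yes; no)
open import Relation.Nullary.Decidable using (⌊_⌋; isYes≗does; dec-true; dec-false; does-⇔; toWitness)

Positive : ∀ {k} → Vec ℕ k → Set
Positive {k} r = ∀ (i : Fin k) → 1 ≤ lookup r i

Increasing : ∀ {k} → Vec ℤ k → Set
Increasing {k} a = ∀ (i j : Fin k) → i Fin.< j → lookup a i ℤ.< lookup a j

Positive-tail : ∀ {k r₀} {r : Vec ℕ k} → Positive (r₀ ∷ r) → Positive r
Positive-tail pos i = pos (suc i)

Increasing-tail : ∀ {k a₀} {a : Vec ℤ k} → Increasing (a₀ ∷ a) → Increasing a
Increasing-tail inc i j i<j = inc (suc i) (suc j) (s<s i<j)

-- weight X = Σ_j j x_j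
weight : ∀ {k} → Vec ℕ k → ℕ
weight []       = 0
weight (x ∷ xs) = sum xs + weight xs

weight≤ : ∀ {k} (X : Vec ℕ k) → weight X ≤ k * sum X
weight≤ []              = z≤n
weight≤ {suc k} (x ∷ X) =
  ≤-trans (+-monoʳ-≤ (sum X) (weight≤ X)) (*-monoʳ-≤ (suc k) (m≤n+m (sum X) x))

sum-replicate-0 : ∀ k → sum (replicate k 0) ≡ 0
sum-replicate-0 zero    = refl
sum-replicate-0 (suc k) = sum-replicate-0 k

weight-replicate-0 : ∀ k → weight (replicate k 0) ≡ 0
weight-replicate-0 zero    = refl
weight-replicate-0 (suc k) = cong₂ _+_ (sum-replicate-0 k) (weight-replicate-0 k)

sum≡0⇒replicate-0 : ∀ {k} (X : Vec ℕ k) → sum X ≡ 0 → X ≡ replicate k 0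
sum≡0⇒replicate-0 []         _  = refl
sum≡0⇒replicate-0 (zero ∷ X) eq = cong (0 ∷_) (sum≡0⇒replicate-0 X eq)

at-ext : ∀ {k} {X Y : Vec ℕ k} → (∀ i → i < k → at X i ≡ at Y i) → X ≡ Y
at-ext {X = []}    {[]}    _  = refl
at-ext {X = x ∷ X} {y ∷ Y} eq = cong₂ _∷_ (eq 0 z<s) (at-ext λ i i<k → eq (suc i) (s<s i<k))

InR-head : ∀ {k r₀ x h} (r X : Vec ℕ k) → InR (r₀ ∷ r) h (x ∷ X) → x ≤ r₀
InR-head _ _ (_ , X≤r) = X≤r zero

InR-tail : ∀ {k r₀ x h} (r X : Vec ℕ k) → InR (r₀ ∷ r) h (x ∷ X) → InR r (sum X) X
InR-tail _ _ (_ , X≤r) = refl , λ i → X≤r (suc i)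

InR-∷ : ∀ {k r₀ x s} {r X : Vec ℕ k} → x ≤ r₀ → InR r s X → InR (r₀ ∷ r) (x + s) (x ∷ X)
InR-∷ x≤r₀ (refl , X≤r) = refl , λ { zero → x≤r₀ ; (suc i) → X≤r i }

InR-sum≤ : ∀ {k h} (r X : Vec ℕ k) → InR r h X → h ≤ sum r
InR-sum≤ []       []      (refl , _)       = z≤n
InR-sum≤ (r₀ ∷ r) (x ∷ X) X∈R@(refl , _) = +-mono-≤ (InR-head r X X∈R) (InR-sum≤ r X (InR-tail r X X∈R))

InR-full : ∀ {k} (r X : Vec ℕ k) → InR r (sum r) X → X ≡ r
InR-full []       []      _   = refl
InR-full (r₀ ∷ r) (x ∷ X) X∈R with m≤n⇒m<n∨m≡n (InR-head r X X∈R)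
... | inj₂ refl =
  cong (x ∷_) (InR-full r X (subst (λ s → InR r s X) (+-cancelˡ-≡ x _ _ (proj₁ X∈R)) (InR-tail r X X∈R)))
... | inj₁ x<r₀ =
  ⊥-elim (<-irrefl (proj₁ X∈R) (+-mono-<-≤ x<r₀ (InR-sum≤ r X (InR-tail r X X∈R))))

InR-shiftLeft : ∀ {k r₀ r₁ x c h} {r T : Vec ℕ k} →
  x < r₀ → InR (r₀ ∷ r₁ ∷ r) h (x ∷ suc c ∷ T) → InR (r₀ ∷ r₁ ∷ r) h (suc x ∷ c ∷ T)
InR-shiftLeft {r₀ = r₀} {r₁} {x} {c} {r = r} {T} x<r₀ (ΣX≡h , X≤r) =
  trans (sym (+-suc x (c + sum T))) ΣX≡h , Y≤r
  where
  Y≤r : ∀ i → lookup (suc x ∷ c ∷ T) i ≤ lookup (r₀ ∷ r₁ ∷ r) i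
  Y≤r zero          = x<r₀
  Y≤r (suc zero)    = ≤-trans (n≤1+n c) (X≤r (suc zero))
  Y≤r (suc (suc i)) = X≤r (suc (suc i))

InR-shiftRight : ∀ {k r₀ r₁ x c h} {r T : Vec ℕ k} →
  c < r₁ → InR (r₀ ∷ r₁ ∷ r) h (suc x ∷ c ∷ T) → InR (r₀ ∷ r₁ ∷ r) h (x ∷ suc c ∷ T)
InR-shiftRight {r₀ = r₀} {r₁} {x} {c} {r = r} {T} c<r₁ (ΣX≡h , X≤r) =
  trans (+-suc x (c + sum T)) ΣX≡h , Y≤r
  where
  Y≤r : ∀ i → lookup (x ∷ suc c ∷ T) i ≤ lookup (r₀ ∷ r₁ ∷ r) i
  Y≤r zero          = ≤-trans (n≤1+n x) (X≤r zero)
  Y≤r (suc zero)    = c<r₁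
  Y≤r (suc (suc i)) = X≤r (suc (suc i))

infix 4 _↝_

data _↝_ : ∀ {k} → Vec ℕ k → Vec ℕ k → Set where
  here  : ∀ {k x y} {zs : Vec ℕ k} → suc x ∷ y ∷ zs ↝ x ∷ suc y ∷ zs
  there : ∀ {k x} {xs ys : Vec ℕ k} → xs ↝ ys → x ∷ xs ↝ x ∷ ys

Step⇒↝ : ∀ {k} {U W : Vec ℕ k} → Step U W → U ↝ W
Step⇒↝ {U = []} (_ , () , _)
Step⇒↝ {U = _ ∷ []} (zero , s<s () , _)
Step⇒↝ {U = u ∷ u′ ∷ U} {w ∷ w′ ∷ W} (zero , _ , w+1≡u , w′≡u′+1 , others)
  with refl ← trans (+-comm 1 w) w+1≡u
     | refl ← trans w′≡u′+1 (+-comm u′ 1)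
     | refl ← at-ext {X = W} {U} (λ i i<k → others (2 + i) (s<s (s<s i<k)) (λ ()) (λ ()))
  = here
Step⇒↝ {U = u ∷ U} {w ∷ W} (suc j , s<s j+1<k , w+1≡u , w′≡u′+1 , others)
  with refl ← others 0 z<s (λ ()) (λ ())
  = there (Step⇒↝ (j , j+1<k , w+1≡u , w′≡u′+1 , λ i i<k i≢j i≢j+1 →
      others (suc i) (s<s i<k) (i≢j ∘ suc-injective) (i≢j+1 ∘ suc-injective)))

↝-sum : ∀ {k} {X Y : Vec ℕ k} → X ↝ Y → sum Y ≡ sum X
↝-sum (here {x = x} {y} {zs}) = +-suc x (y + sum zs)
↝-sum (there {x = x} X↝Y)     = cong (_+_ x) (↝-sum X↝Y)

↝-weight : ∀ {k} {X Y : Vec ℕ k} → X ↝ Y → weight Y ≡ suc (weight X)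
↝-weight here                  = refl
↝-weight (there {xs = xs} X↝Y) = trans (cong₂ _+_ (↝-sum X↝Y) (↝-weight X↝Y)) (+-suc (sum xs) _)

↝-φ : ∀ {k} {a : Vec ℤ k} {X Y} → Increasing a → X ↝ Y → φ a X ℤ.< φ a Y
↝-φ {a = a₀ ∷ a₁ ∷ as} inc (here {x = x} {y} {zs}) =
  subst₂ ℤ._<_ (sym φX) (sym φY) (ℤₚ.+-monoˡ-< c (inc zero (suc zero) z<s))
  where
  c = + x ℤ.* a₀ ℤ.+ (+ y ℤ.* a₁ ℤ.+ φ as zs)
  regroup : ∀ (u p q s : ℤ) → p ℤ.+ ((u ℤ.+ q) ℤ.+ s) ≡ u ℤ.+ (p ℤ.+ (q ℤ.+ s))
  regroup = ℤ-Ring.solve-∀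
  φX : φ (a₀ ∷ a₁ ∷ as) (suc x ∷ y ∷ zs) ≡ a₀ ℤ.+ c
  φX = trans (cong (ℤ._+ (+ y ℤ.* a₁ ℤ.+ φ as zs)) (ℤₚ.suc-* (+ x) a₀))
             (ℤₚ.+-assoc a₀ (+ x ℤ.* a₀) _)
  φY : φ (a₀ ∷ a₁ ∷ as) (x ∷ suc y ∷ zs) ≡ a₁ ℤ.+ c
  φY = trans (cong (λ t → + x ℤ.* a₀ ℤ.+ (t ℤ.+ φ as zs)) (ℤₚ.suc-* (+ y) a₁))
             (regroup a₁ (+ x ℤ.* a₀) (+ y ℤ.* a₁) (φ as zs))
↝-φ {a = a₀ ∷ as} inc (there {x = x} X↝Y) =
  ℤₚ.+-monoʳ-< (+ x ℤ.* a₀) (↝-φ {a = as} (Increasing-tail inc) X↝Y)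

IsPath-weight : ∀ {k h t P} {r : Vec ℕ k} → IsPath r h t P →
  ∀ i → suc i ≤ t → weight (P (suc i)) ≡ i + weight (P 1)
IsPath-weight _ zero _ = refl
IsPath-weight {h = h} {P = P} {r} path@(_ , steps) (suc i) i+2≤t =
  trans (↝-weight (Step⇒↝ {U = P (suc i)} {P (suc (suc i))} (steps (suc i) (s≤s z≤n) i+2≤t)))
        (cong suc (IsPath-weight {h = h} {P = P} {r} path i (<⇒≤ i+2≤t)))

IsPath-sameStart⇒sameWeight : ∀ {k h t P P′} {r : Vec ℕ k} → IsPath r h t P → IsPath r h t P′ →
  P 1 ≡ P′ 1 → ∀ i → suc i ≤ t → weight (P (suc i)) ≡ weight (P′ (suc i))
IsPath-sameStart⇒sameWeight {h = h} {P = P} {P′} {r} P-path P′-path P₁≡P′₁ i i+1≤t = begin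
  weight (P (suc i))    ≡⟨ IsPath-weight {h = h} {P = P} {r} P-path i i+1≤t ⟩
  i + weight (P 1)      ≡⟨ cong (λ X → i + weight X) P₁≡P′₁ ⟩
  i + weight (P′ 1)     ≡⟨ IsPath-weight {h = h} {P = P′} {r} P′-path i i+1≤t ⟨
  weight (P′ (suc i))   ∎
  where open ≡-Reasoning

packLeft : ∀ {k} → Vec ℕ k → ℕ → Vec ℕ k
packLeft []       h = []
packLeft (r₀ ∷ r) h with r₀ ≤? h
... | yes _ = r₀ ∷ packLeft r (h ∸ r₀)
... | no  _ = h ∷ replicate _ 0

packRight : ∀ {k} → Vec ℕ k → ℕ → Vec ℕ k
packRight []       h = []
packRight (r₀ ∷ r) h with h ≤? sum r
... | yes _ = 0 ∷ packRight r h
... | no  _ = (h ∸ sum r) ∷ r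

packLeft-sum : ∀ {k h} (r : Vec ℕ k) → h ≤ sum r → sum (packLeft r h) ≡ h
packLeft-sum []                 z≤n  = refl
packLeft-sum {suc k} {h} (r₀ ∷ r) h≤Σr with r₀ ≤? h
... | yes r₀≤h = trans (cong (_+_ r₀) (packLeft-sum r (m≤n+o⇒m∸n≤o h r₀ h≤Σr))) (m+[n∸m]≡n r₀≤h)
... | no  _    = trans (cong (_+_ h) (sum-replicate-0 k)) (+-identityʳ h)

packRight-sum : ∀ {k h} (r : Vec ℕ k) → h ≤ sum r → sum (packRight r h) ≡ h
packRight-sum []                 z≤n = refl
packRight-sum {h = h} (r₀ ∷ r) _ with h ≤? sum r
... | yes h≤Σr = packRight-sum r h≤Σr
... | no  h≰Σr = m∸n+n≡m (<⇒≤ (≰⇒> h≰Σr))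

packLeft-below : ∀ {k x r₀} {r : Vec ℕ k} → x < r₀ → packLeft (r₀ ∷ r) x ≡ x ∷ replicate k 0
packLeft-below {x = x} {r₀} x<r₀ with r₀ ≤? x
... | yes r₀≤x = ⊥-elim (<⇒≱ x<r₀ r₀≤x)
... | no  _    = refl

packLeft-fullHead : ∀ {k r₀ s} {r : Vec ℕ k} → packLeft (r₀ ∷ r) (r₀ + s) ≡ r₀ ∷ packLeft r s
packLeft-fullHead {r₀ = r₀} {s} {r} with r₀ ≤? r₀ + s
... | yes _   = cong (λ t → r₀ ∷ packLeft r t) (m+n∸m≡n r₀ s)
... | no  r₀≰ = ⊥-elim (r₀≰ (m≤m+n r₀ s))

packLeft-head : ∀ {k r₁ s} {r : Vec ℕ k} → 1 ≤ r₁ → 1 ≤ s →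
  ∃₂ λ c T → packLeft (r₁ ∷ r) s ≡ suc c ∷ T
packLeft-head {r₁ = suc c} {suc s} (s≤s _) (s≤s _) with suc c ≤? suc s
... | yes _ = c , _ , refl
... | no  _ = s , _ , refl

packRight-below : ∀ {k r₀ s} {r : Vec ℕ k} → s ≤ sum r → packRight (r₀ ∷ r) s ≡ 0 ∷ packRight r s
packRight-below {s = s} {r} s≤Σr with s ≤? sum r
... | yes _    = refl
... | no  s≰Σr = ⊥-elim (s≰Σr s≤Σr)

packRight-fullTail : ∀ {k r₀ x} {r : Vec ℕ k} → packRight (r₀ ∷ r) (suc x + sum r) ≡ suc x ∷ r
packRight-fullTail {x = x} {r} with suc x + sum r ≤? sum r
... | yes ≤Σr = ⊥-elim (<⇒≱ (m<n+m (sum r) z<s) ≤Σr)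
... | no  _   = cong (_∷ r) (m+n∸n≡m (suc x) (sum r))

packRight-head : ∀ {k r₁ s} {r : Vec ℕ k} → 1 ≤ r₁ → s < r₁ + sum r →
  ∃₂ λ c T → packRight (r₁ ∷ r) s ≡ c ∷ T × c < r₁
packRight-head {r₁ = suc r₁} {s} {r} 1≤r₁ s<Σ with s ≤? sum r
... | yes _ = 0 , _ , refl , 1≤r₁
... | no  _ = s ∸ sum r , _ , refl , m<n+o⇒m∸n<o s (sum r) (subst (s <_) (+-comm (suc r₁) (sum r)) s<Σ)

packLeft-or-↝-packedTail : ∀ {k x r₀} {r X : Vec ℕ k} → Positive r → x < r₀ → X ≡ packLeft r (sum X) →
  InR (r₀ ∷ r) (x + sum X) (x ∷ X) →
  x ∷ X ≡ packLeft (r₀ ∷ r) (x + sum X) ⊎ ∃ λ Y → InR (r₀ ∷ r) (x + sum X) Y × Y ↝ x ∷ X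
packLeft-or-↝-packedTail {X = X} _ _ _ _ with m≤n⇒m<n∨m≡n (z≤n {sum X})
packLeft-or-↝-packedTail {k} {x} {X = X} _ x<r₀ _ _ | inj₂ 0≡ΣX
  with refl ← sum≡0⇒replicate-0 X (sym 0≡ΣX) rewrite sum-replicate-0 k | +-identityʳ x =
  inj₁ (sym (packLeft-below x<r₀))
packLeft-or-↝-packedTail {r = []} {[]} _ _ _ _ | inj₁ ()
packLeft-or-↝-packedTail {x = x} {r₀} {r₁ ∷ r} {X} pos x<r₀ X≡ X∈R | inj₁ 0<ΣX
  with packLeft-head {r = r} (pos zero) 0<ΣX
... | c , T , packed≡ with refl ← trans X≡ packed≡ =
  inj₂ (suc x ∷ c ∷ T , InR-shiftLeft x<r₀ X∈R , here)

packLeft-or-↝ : ∀ {k h} (r X : Vec ℕ k) → Positive r → InR r h X →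
  X ≡ packLeft r h ⊎ ∃ λ Y → InR r h Y × Y ↝ X
packLeft-or-↝ []       []      _   (refl , _) = inj₁ refl
packLeft-or-↝ (r₀ ∷ r) (x ∷ X) pos X∈R@(refl , _)
  with packLeft-or-↝ r X (Positive-tail pos) (InR-tail r X X∈R)
... | inj₂ (Y , Y∈R , Y↝X) = inj₂ (x ∷ Y , InR-∷ (InR-head r X X∈R) Y∈R , there Y↝X)
... | inj₁ X≡ with m≤n⇒m<n∨m≡n (InR-head r X X∈R)
...   | inj₁ x<r₀ = packLeft-or-↝-packedTail (Positive-tail pos) x<r₀ X≡ X∈R
...   | inj₂ refl = inj₁ (trans (cong (x ∷_) X≡) (sym packLeft-fullHead))

packRight-or-↝-packedTail : ∀ {k x r₀} {r X : Vec ℕ k} → Positive r → X ≡ packRight r (sum X) →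
  InR (r₀ ∷ r) (x + sum X) (x ∷ X) →
  x ∷ X ≡ packRight (r₀ ∷ r) (x + sum X) ⊎ ∃ λ Y → InR (r₀ ∷ r) (x + sum X) Y × x ∷ X ↝ Y
packRight-or-↝-packedTail {x = zero} {r₀} {r} {X} _ X≡ X∈R =
  inj₁ (trans (cong (0 ∷_) X≡) (sym (packRight-below {r₀ = r₀} (InR-sum≤ r X (InR-tail r X X∈R)))))
packRight-or-↝-packedTail {x = suc x} {r₀} {r} {X} pos X≡ X∈R
  with m≤n⇒m<n∨m≡n (InR-sum≤ r X (InR-tail r X X∈R))
... | inj₂ ΣX≡Σr with refl ← InR-full r X (subst (λ s → InR r s X) ΣX≡Σr (InR-tail r X X∈R)) =
  inj₁ (sym (packRight-fullTail {r₀ = r₀}))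
packRight-or-↝-packedTail {x = suc x} {r = r₁ ∷ r} {X} pos X≡ X∈R | inj₁ ΣX<Σr
  with packRight-head {r = r} (pos zero) ΣX<Σr
... | c , T , packed≡ , c<r₁ with refl ← trans X≡ packed≡ =
  inj₂ (x ∷ suc c ∷ T , InR-shiftRight c<r₁ X∈R , here)

packRight-or-↝ : ∀ {k h} (r X : Vec ℕ k) → Positive r → InR r h X →
  X ≡ packRight r h ⊎ ∃ λ Y → InR r h Y × X ↝ Y
packRight-or-↝ []       []      _   (refl , _) = inj₁ refl
packRight-or-↝ (r₀ ∷ r) (x ∷ X) pos X∈R@(refl , _)
  with packRight-or-↝ r X (Positive-tail pos) (InR-tail r X X∈R)
... | inj₂ (Y , Y∈R , X↝Y) = inj₂ (x ∷ Y , InR-∷ (InR-head r X X∈R) Y∈R , there X↝Y)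
... | inj₁ X≡              = packRight-or-↝-packedTail (Positive-tail pos) X≡ X∈R

module _ {A V : Set} (S : A → Set) (μ : A → ℕ) (f : A → V)
         {_≺_ : V → V → Set} (≺-trans : Transitive _≺_) (≺-irrefl : ∀ {v} → ¬ v ≺ v) (bottom : A)
         (descend : ∀ {X} → S X → X ≡ bottom ⊎ ∃ λ Y → S Y × suc (μ Y) ≡ μ X × f Y ≺ f X) where

  descendingValues : ∀ n {X} → μ X ≡ n → S X →
    ∃ λ vs → length vs + μ bottom ≡ suc (μ X) × Unique vs × All (λ v → ¬ f X ≺ v) vs
           × All (λ v → ∃ λ Y → S Y × f Y ≡ v) vs
  descendingValues n {X} μX≡n X∈S with descend X∈S
  ... | inj₁ refl = f X ∷ [] , refl , [] ∷ [] , ≺-irrefl ∷ [] , (X , X∈S , refl) ∷ []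
  ... | inj₂ (Y , Y∈S , μY<μX , fY≺fX) with n
  ...   | zero with () ← trans μY<μX μX≡n
  ...   | suc m
    with vs , |vs| , unique , below , attained ← descendingValues m (suc-injective (trans μY<μX μX≡n)) Y∈S =
    f X ∷ vs ,
    cong suc (trans |vs| μY<μX) ,
    All.map (λ fY⊀v fX≡v → fY⊀v (subst (f Y ≺_) fX≡v fY≺fX)) below ∷ unique ,
    ≺-irrefl ∷ All.map (λ fY⊀v fX≺v → fY⊀v (≺-trans fY≺fX fX≺v)) below ,
    (X , X∈S , refl) ∷ attained

sumsBelow : ∀ {k h} {r X : Vec ℕ k} {a : Vec ℤ k} → Positive r → Increasing a → InR r h X →
  ∃ λ cs → length cs + weight (packLeft r h) ≡ suc (weight X)
         × Unique cs × All (ℤ._≤ φ a X) cs × All (InSumset r h a) cs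
sumsBelow {h = h} {r} {X} {a} pos inc X∈R =
  let cs , |cs| , unique , below , inSumset = descendingValues (InR r h) weight (φ a)
        ℤₚ.<-trans (ℤₚ.<-irrefl refl) (packLeft r h) descend _ refl X∈R
  in cs , |cs| , unique , All.map ℤₚ.≮⇒≥ below , inSumset
  where
  descend : ∀ {X} → InR r h X →
    X ≡ packLeft r h ⊎ ∃ λ Y → InR r h Y × suc (weight Y) ≡ weight X × φ a Y ℤ.< φ a X
  descend {X} X∈R = map₂ (λ (Y , Y∈R , Y↝X) → Y , Y∈R , sym (↝-weight Y↝X) , ↝-φ {a = a} inc Y↝X)
                         (packLeft-or-↝ r X pos X∈R)

-- Ascending chains descend in the co-weight k h ∸ w, which is exact since w ≤ k h on R(r,h).
sumsAbove : ∀ {k h} {r X : Vec ℕ k} {a : Vec ℤ k} → Positive r → Increasing a → InR r h X →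
  ∃ λ ds → length ds + weight X ≡ suc (weight (packRight r h))
         × Unique ds × All (φ a X ℤ.≤_) ds × All (InSumset r h a) ds
sumsAbove {k} {h} {r} {X} {a} pos inc X∈R =
  let ds , |ds| , unique , above , inSumset = descendingValues (InR r h) coweight (φ a)
        (flip ℤₚ.<-trans) (ℤₚ.<-irrefl refl) (packRight r h) ascend _ refl X∈R
  in ds , uncoweight {length ds} (weight≤kh {X} X∈R) packRight-weight≤kh |ds| ,
     unique , All.map ℤₚ.≮⇒≥ above , inSumset
  where
  coweight : Vec ℕ k → ℕ
  coweight X = k * h ∸ weight X
  weight≤kh : ∀ {X} → InR r h X → weight X ≤ k * h
  weight≤kh {X} (refl , _) = weight≤ X
  packRight-weight≤kh : weight (packRight r h) ≤ k * h
  packRight-weight≤kh =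
    subst (λ s → weight (packRight r h) ≤ k * s) (packRight-sum r (InR-sum≤ r X X∈R)) (weight≤ (packRight r h))
  ascend : ∀ {X} → InR r h X →
    X ≡ packRight r h ⊎ ∃ λ Y → InR r h Y × suc (coweight Y) ≡ coweight X × φ a X ℤ.< φ a Y
  ascend {X} X∈R = map₂ (λ (Y , Y∈R , X↝Y) → Y , Y∈R ,
      trans (sym (+-∸-assoc 1 (weight≤kh {Y} Y∈R))) (cong (suc (k * h) ∸_) (↝-weight X↝Y)) ,
      ↝-φ {a = a} inc X↝Y)
    (packRight-or-↝ r X pos X∈R)
  uncoweight : ∀ {n u v} → u ≤ k * h → v ≤ k * h → n + (k * h ∸ v) ≡ suc (k * h ∸ u) → n + u ≡ suc v
  uncoweight {n} {u} {v} u≤kh v≤kh eq = +-cancelʳ-≡ (k * h) (n + u) (suc v) (begin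
    n + u + k * h              ≡⟨ cong (_+_ (n + u)) (sym (m∸n+n≡m v≤kh)) ⟩
    n + u + (k * h ∸ v + v)    ≡⟨ interchange n u (k * h ∸ v) v ⟩
    n + (k * h ∸ v) + (u + v)  ≡⟨ cong (_+ (u + v)) eq ⟩
    suc (k * h ∸ u + (u + v))  ≡⟨ cong suc (sym (+-assoc (k * h ∸ u) u v)) ⟩
    suc (k * h ∸ u + u + v)    ≡⟨ cong (λ t → suc (t + v)) (m∸n+n≡m u≤kh) ⟩
    suc (k * h + v)            ≡⟨ cong suc (+-comm (k * h) v) ⟩
    suc v + k * h              ∎)
    where open ≡-Reasoning

Unique-lookup-injective : ∀ {A : Set} {xs : List A} → Unique xs →
  ∀ {i j} → List.lookup xs i ≡ List.lookup xs j → i ≡ j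
Unique-lookup-injective {xs = _ ∷ _} _          {zero}  {zero}  _  = refl
Unique-lookup-injective {xs = _ ∷ _} (x∉ ∷ _)   {zero}  {suc j} eq = ⊥-elim (All.lookup x∉ (∈-lookup j) eq)
Unique-lookup-injective {xs = _ ∷ _} (x∉ ∷ _)   {suc i} {zero}  eq = ⊥-elim (All.lookup x∉ (∈-lookup i) (sym eq))
Unique-lookup-injective {xs = _ ∷ _} (_ ∷ uniq) {suc i} {suc j} eq = cong suc (Unique-lookup-injective uniq eq)

Unique⇒length≤ : ∀ {A : Set} {xs ys : List A} → Unique xs → xs ⊆ ys → length xs ≤ length ys
Unique⇒length≤ {xs = xs} {ys} uniq xs⊆ys = injective⇒≤ {f = position} position-injective
  where
  position : Fin (length xs) → Fin (length ys)
  position i = index (xs⊆ys (∈-lookup i))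
  lookup-position : ∀ i → List.lookup xs i ≡ List.lookup ys (position i)
  lookup-position i = lookup-index (xs⊆ys (∈-lookup i))
  position-injective : ∀ {i j} → position i ≡ position j → i ≡ j
  position-injective {i} {j} eq = Unique-lookup-injective uniq
    (trans (lookup-position i) (trans (cong (List.lookup ys) eq) (sym (lookup-position j))))

equalWeight⇒equalφ : ∀ {k h n} {r X Y : Vec ℕ k} {a : Vec ℤ k} → Positive r → Increasing a →
  n + weight (packLeft r h) ≡ suc (weight (packRight r h)) → HasCard (InSumset r h a) n →
  InR r h X → InR r h Y → weight X ≡ weight Y → φ a X ≡ φ a Y
equalWeight⇒equalφ {h = h} {n} {r} {a = a} pos inc spread (sumset , _ , sumset⇔ , |sumset|≡n) X∈R Y∈R wX≡wY =
  ℤₚ.≤-antisym (ℤₚ.≮⇒≥ (φ≮ Y∈R X∈R (sym wX≡wY))) (ℤₚ.≮⇒≥ (φ≮ X∈R Y∈R wX≡wY))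
  where
  total-length : ∀ {c d m w M} → c + m ≡ suc w → d + w ≡ suc M → n + m ≡ suc M → c + d ≡ suc n
  total-length {c} {d} {m} {w} cm dw nm = +-cancelʳ-≡ m (c + d) (suc n) (begin
    c + d + m      ≡⟨ xy∙z≈xz∙y c d m ⟩
    c + m + d      ≡⟨ cong (_+ d) cm ⟩
    suc (w + d)    ≡⟨ cong suc (+-comm w d) ⟩
    suc (d + w)    ≡⟨ cong suc (trans dw (sym nm)) ⟩
    suc (n + m)    ∎)
    where open ≡-Reasoning
  φ≮ : ∀ {X Y} → InR r h X → InR r h Y → weight X ≡ weight Y → ¬ φ a X ℤ.< φ a Y
  φ≮ {X} {Y} X∈R Y∈R wX≡wY φX<φY =
    let cs , |cs| , cs-unique , cs≤φX , cs∈sumset = sumsBelow {r = r} {X} {a} pos inc X∈R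
        ds , |ds| , ds-unique , φY≤ds , ds∈sumset = sumsAbove {r = r} {Y} {a} pos inc Y∈R
        disjoint : ∀ {v} → ¬ (v ∈ cs × v ∈ ds)
        disjoint (v∈cs , v∈ds) = ℤₚ.<-irrefl refl
          (ℤₚ.<-≤-trans φX<φY (ℤₚ.≤-trans (All.lookup φY≤ds v∈ds) (All.lookup cs≤φX v∈cs)))
        sums⊆sumset : cs ++ ds ⊆ sumset
        sums⊆sumset v∈ = Equivalence.from (sumset⇔ _) (All.lookup (All.++⁺ cs∈sumset ds∈sumset) v∈)
        |sums|≤n : length (cs ++ ds) ≤ n
        |sums|≤n = subst (length (cs ++ ds) ≤_) |sumset|≡n
          (Unique⇒length≤ (Unique.++⁺ cs-unique ds-unique disjoint) sums⊆sumset)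
        |sums|≡1+n : length (cs ++ ds) ≡ suc n
        |sums|≡1+n = trans (length-++ cs)
          (total-length |cs| (subst (λ w → length ds + w ≡ _) (sym wX≡wY) |ds|) spread)
    in <-irrefl refl (subst (_≤ n) |sums|≡1+n |sums|≤n)

largestUpTo-suc : ∀ n (P Q : ℕ → Bool) → (∀ i → P (suc i) ≡ Q i) → Q 0 ≡ true →
  largestUpTo (suc n) P ≡ suc (largestUpTo n Q)
largestUpTo-suc zero    P Q P≗Q q₀ rewrite P≗Q 0 | q₀ = refl
largestUpTo-suc (suc n) P Q P≗Q q₀ rewrite P≗Q (suc n) with Q (suc n)
... | true  = refl
... | false = largestUpTo-suc n P Q P≗Q q₀

largestUpTo-≡0 : ∀ n (P : ℕ → Bool) → (∀ i → P (suc i) ≡ false) → largestUpTo n P ≡ 0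
largestUpTo-≡0 zero    P _     = refl
largestUpTo-≡0 (suc n) P never rewrite never n = largestUpTo-≡0 n P never

largestUpTo-sound : ∀ n (P : ℕ → Bool) → P 0 ≡ true → P (largestUpTo n P) ≡ true
largestUpTo-sound zero    P p₀ = p₀
largestUpTo-sound (suc n) P p₀ with P (suc n) in pₙ
... | true  = pₙ
... | false = largestUpTo-sound n P p₀

leastUpTo-zero : ∀ n (Q : ℕ → Bool) → Q 0 ≡ true → leastUpTo n Q ≡ 0
leastUpTo-zero zero    Q _  = refl
leastUpTo-zero (suc n) Q q₀ rewrite q₀ = refl

leastUpTo-suc : ∀ n (Q : ℕ → Bool) → Q 0 ≡ false → leastUpTo (suc n) Q ≡ suc (leastUpTo n (Q ∘ suc))
leastUpTo-suc n Q q₀ rewrite q₀ = refl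

leastUpTo-cong : ∀ n (Q Q′ : ℕ → Bool) → (∀ i → Q i ≡ Q′ i) → leastUpTo n Q ≡ leastUpTo n Q′
leastUpTo-cong zero    Q Q′ Q≗Q′ = refl
leastUpTo-cong (suc n) Q Q′ Q≗Q′ rewrite Q≗Q′ 0 =
  cong (λ m → if Q′ 0 then 0 else suc m) (leastUpTo-cong n (Q ∘ suc) (Q′ ∘ suc) (Q≗Q′ ∘ suc))

leastUpTo-sound : ∀ n (Q : ℕ → Bool) → Q n ≡ true → Q (leastUpTo n Q) ≡ true
leastUpTo-sound zero    Q qₙ = qₙ
leastUpTo-sound (suc n) Q qₙ with Q 0 in q₀
... | true  = q₀
... | false = leastUpTo-sound n (Q ∘ suc) qₙ

⌊⌋-true : ∀ {A : Set} (a? : Dec A) → A → ⌊ a? ⌋ ≡ true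
⌊⌋-true a? a = trans (isYes≗does a?) (dec-true a? a)

⌊⌋-false : ∀ {A : Set} (a? : Dec A) → ¬ A → ⌊ a? ⌋ ≡ false
⌊⌋-false a? ¬a = trans (isYes≗does a?) (dec-false a? ¬a)

⌊⌋-true⁻¹ : ∀ {A : Set} (a? : Dec A) → ⌊ a? ⌋ ≡ true → A
⌊⌋-true⁻¹ a? ⌊a?⌋≡true = toWitness {a? = a?} (Equivalence.from T-≡ ⌊a?⌋≡true)

⌊⌋-⇔ : ∀ {A B : Set} → A ⇔ B → (a? : Dec A) (b? : Dec B) → ⌊ a? ⌋ ≡ ⌊ b? ⌋
⌊⌋-⇔ A⇔B a? b? = trans (isYes≗does a?) (trans (does-⇔ A⇔B a? b?) (sym (isYes≗does b?)))

sumFrom-suc : ∀ f a n → sumFrom f (suc a) n ≡ sumFrom (f ∘ suc) a n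
sumFrom-suc f a zero    = refl
sumFrom-suc f a (suc n) = cong (_+_ (f (suc a))) (sumFrom-suc f (suc a) n)

sumFrom-+ : ∀ f g a n → sumFrom (λ j → f j + g j) a n ≡ sumFrom f a n + sumFrom g a n
sumFrom-+ f g a zero    = refl
sumFrom-+ f g a (suc n) =
  trans (cong (_+_ (f a + g a)) (sumFrom-+ f g (suc a) n)) (interchange (f a) (g a) _ _)

moment : ∀ {k} → Vec ℕ k → ℕ → ℕ
moment r j = j * at r j

sumFrom-moment-∷ : ∀ {k} x (xs : Vec ℕ k) a n →
  sumFrom (moment (x ∷ xs)) (suc a) n ≡ sumFrom (at xs) a n + sumFrom (moment xs) a n
sumFrom-moment-∷ x xs a n = trans (sumFrom-suc (moment (x ∷ xs)) a n) (sumFrom-+ (at xs) (moment xs) a n)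

sumFrom-at : ∀ {k} (xs : Vec ℕ k) → sumFrom (at xs) 0 k ≡ sum xs
sumFrom-at []               = refl
sumFrom-at {suc k} (x ∷ xs) = cong (_+_ x) (trans (sumFrom-suc (at (x ∷ xs)) 0 k) (sumFrom-at xs))

sumFrom-moment : ∀ {k} (xs : Vec ℕ k) → sumFrom (moment xs) 0 k ≡ weight xs
sumFrom-moment []               = refl
sumFrom-moment {suc k} (x ∷ xs) =
  trans (sumFrom-moment-∷ x xs 0 k) (cong₂ _+_ (sumFrom-at xs) (sumFrom-moment xs))

prefixFits : ∀ {k} → Vec ℕ k → ℕ → ℕ → Bool
prefixFits r h i = ⌊ sumRange (at r) 0 i ≤? h ⌋

suffixFits : ∀ {k} → Vec ℕ k → ℕ → ℕ → Bool
suffixFits {k} r h m = ⌊ sumRange (at r) m k ≤? h ⌋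

Ir-∷-≤ : ∀ {k r₀ h} {r : Vec ℕ k} → r₀ ≤ h → Ir (r₀ ∷ r) h ≡ suc (Ir r (h ∸ r₀))
Ir-∷-≤ {k} {r₀} {h} {r} r₀≤h =
  largestUpTo-suc k (prefixFits (r₀ ∷ r) h) (prefixFits r (h ∸ r₀)) shift (⌊⌋-true (0 ≤? h ∸ r₀) z≤n)
  where
  r₀+≤⇔≤∸ : ∀ s → (r₀ + s ≤ h) ⇔ (s ≤ h ∸ r₀)
  r₀+≤⇔≤∸ s = mk⇔ (λ le → m+n≤o⇒m≤o∸n s (subst (_≤ h) (+-comm r₀ s) le))
                  (λ le → subst (_≤ h) (+-comm s r₀) (m≤o∸n⇒m+n≤o s r₀≤h le))
  shift : ∀ i → ⌊ r₀ + sumFrom (at (r₀ ∷ r)) 1 i ≤? h ⌋ ≡ ⌊ sumFrom (at r) 0 i ≤? h ∸ r₀ ⌋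
  shift i = trans (cong (λ s → ⌊ r₀ + s ≤? h ⌋) (sumFrom-suc (at (r₀ ∷ r)) 0 i))
                  (⌊⌋-⇔ (r₀+≤⇔≤∸ (sumFrom (at r) 0 i)) _ _)

Ir-∷-> : ∀ {k r₀ h} {r : Vec ℕ k} → h < r₀ → Ir (r₀ ∷ r) h ≡ 0
Ir-∷-> {k} {r₀} {h} {r} h<r₀ = largestUpTo-≡0 (suc k) (prefixFits (r₀ ∷ r) h) λ i →
  ⌊⌋-false (r₀ + sumFrom (at (r₀ ∷ r)) 1 i ≤? h) (λ le → <⇒≱ h<r₀ (m+n≤o⇒m≤o r₀ le))

Ir-sound : ∀ {k h} {r : Vec ℕ k} → sumFrom (at r) 0 (Ir r h) ≤ h
Ir-sound {k} {h} {r} = ⌊⌋-true⁻¹ (sumFrom (at r) 0 (Ir r h) ≤? h)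
  (largestUpTo-sound k (prefixFits r h) (⌊⌋-true (0 ≤? h) z≤n))

Mr+1-≥ : ∀ {k h} {r : Vec ℕ k} → sum r ≤ h → Mr+1 r h ≡ 0
Mr+1-≥ {k} {h} {r} Σr≤h = leastUpTo-zero k (suffixFits r h)
  (⌊⌋-true (sumFrom (at r) 0 k ≤? h) (subst (_≤ h) (sym (sumFrom-at r)) Σr≤h))

Mr+1-∷-< : ∀ {k r₀ h} {r : Vec ℕ k} → h < r₀ + sum r → Mr+1 (r₀ ∷ r) h ≡ suc (Mr+1 r h)
Mr+1-∷-< {k} {r₀} {h} {r} h<Σ = trans
  (leastUpTo-suc k (suffixFits (r₀ ∷ r) h)
    (⌊⌋-false (sumFrom (at (r₀ ∷ r)) 0 (suc k) ≤? h) (<⇒≱ h<Σ ∘ subst (_≤ h) (sumFrom-at (r₀ ∷ r)))))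
  (cong suc (leastUpTo-cong k (suffixFits (r₀ ∷ r) h ∘ suc) (suffixFits r h) λ i →
    cong (λ s → ⌊ s ≤? h ⌋) (sumFrom-suc (at (r₀ ∷ r)) i (k ∸ i))))

Mr+1-sound : ∀ {k h} {r : Vec ℕ k} → sumRange (at r) (Mr+1 r h) k ≤ h
Mr+1-sound {k} {h} {r} = ⌊⌋-true⁻¹ (sumRange (at r) (Mr+1 r h) k ≤? h)
  (leastUpTo-sound k (suffixFits r h)
    (⌊⌋-true (sumRange (at r) k k ≤? h) (subst (λ n → sumFrom (at r) k n ≤ h) (sym (n∸n≡0 k)) z≤n)))

packLeft-weight : ∀ {k h} (r : Vec ℕ k) → h ≤ sum r → ∀ I → I ≡ Ir r h →
  weight (packLeft r h) ≡ sumRange (moment r) 0 I + I * (h ∸ sumRange (at r) 0 I)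
packLeft-weight []                 _    _ refl = refl
packLeft-weight {suc k} {h} (r₀ ∷ r) h≤Σr I I≡ with r₀ ≤? h
... | no h≱r₀ with refl ← trans I≡ (Ir-∷-> (≰⇒> h≱r₀)) =
  cong₂ _+_ (sum-replicate-0 k) (weight-replicate-0 k)
... | yes r₀≤h with refl ← trans I≡ (Ir-∷-≤ r₀≤h) = begin
    sum (packLeft r h′) + weight (packLeft r h′)
      ≡⟨ cong₂ _+_ (packLeft-sum r h′≤Σr) (packLeft-weight r h′≤Σr I′ refl) ⟩
    h′ + (W + I′ * δ)
      ≡⟨ cong (_+ (W + I′ * δ)) (sym (m+[n∸m]≡n (Ir-sound {r = r}))) ⟩
    (S + δ) + (W + I′ * δ)
      ≡⟨ interchange S δ W (I′ * δ) ⟩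
    (S + W) + suc I′ * δ
      ≡⟨ cong₂ _+_ (sym (sumFrom-moment-∷ r₀ r 0 I′)) (cong (suc I′ *_) δ≡) ⟩
    sumFrom (moment (r₀ ∷ r)) 1 I′ + suc I′ * (h ∸ sumFrom (at (r₀ ∷ r)) 0 (suc I′)) ∎
  where
  open ≡-Reasoning
  h′ = h ∸ r₀
  h′≤Σr = m≤n+o⇒m∸n≤o h r₀ h≤Σr
  I′ = Ir r h′
  S = sumFrom (at r) 0 I′
  W = sumFrom (moment r) 0 I′
  δ = h′ ∸ S
  δ≡ : h′ ∸ S ≡ h ∸ sumFrom (at (r₀ ∷ r)) 0 (suc I′)
  δ≡ = trans (∸-+-assoc h r₀ S) (cong (λ s → h ∸ (r₀ + s)) (sym (sumFrom-suc (at (r₀ ∷ r)) 0 I′)))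

-- Stated with θ added on the left, so that M_r(h) = Mr+1 − 1 never has to be subtracted.
packRight-weight : ∀ {k h} (r : Vec ℕ k) → Positive r → h ≤ sum r → ∀ m → m ≡ Mr+1 r h →
  weight (packRight r h) + (h ∸ sumRange (at r) m k) ≡ sumRange (moment r) m k + m * (h ∸ sumRange (at r) m k)
packRight-weight []                 _   z≤n _ refl = refl
packRight-weight {suc k} {h} (r₀ ∷ r) pos h≤Σ m m≡ with h ≤? sum r
... | yes h≤Σr with refl ← trans m≡ (Mr+1-∷-< {r₀ = r₀} {r = r} (≤-<-trans h≤Σr (m<n+m (sum r) (pos zero)))) =
  begin
    sum (packRight r h) + w + θ₀  ≡⟨ cong₂ (λ s t → s + w + t) (packRight-sum r h≤Σr) θ₀≡θ ⟩
    h + w + θ                     ≡⟨ +-assoc h w θ ⟩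
    h + (w + θ)                   ≡⟨ cong (_+_ h) (packRight-weight r (Positive-tail pos) h≤Σr m′ refl) ⟩
    h + (W + m′ * θ)              ≡⟨ cong (_+ (W + m′ * θ)) (sym (m+[n∸m]≡n (Mr+1-sound {r = r}))) ⟩
    (S + θ) + (W + m′ * θ)        ≡⟨ interchange S θ W (m′ * θ) ⟩
    (S + W) + suc m′ * θ
      ≡⟨ cong₂ _+_ (sym (sumFrom-moment-∷ r₀ r m′ (k ∸ m′))) (cong (suc m′ *_) (sym θ₀≡θ)) ⟩
    sumFrom (moment (r₀ ∷ r)) (suc m′) (k ∸ m′) + suc m′ * θ₀ ∎
  where
  open ≡-Reasoning
  m′ = Mr+1 r h
  w = weight (packRight r h)
  S = sumFrom (at r) m′ (k ∸ m′)
  W = sumFrom (moment r) m′ (k ∸ m′)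
  θ = h ∸ S
  θ₀ = h ∸ sumFrom (at (r₀ ∷ r)) (suc m′) (k ∸ m′)
  θ₀≡θ : θ₀ ≡ θ
  θ₀≡θ = cong (h ∸_) (sumFrom-suc (at (r₀ ∷ r)) m′ (k ∸ m′))
... | no h≰Σr with m≤n⇒m<n∨m≡n h≤Σ
...   | inj₁ h<Σ
  with refl ← trans m≡ (trans (Mr+1-∷-< {r₀ = r₀} {r = r} h<Σ)
                              (cong suc (Mr+1-≥ {r = r} (<⇒≤ (≰⇒> h≰Σr))))) =
  cong₂ _+_ (sym (trans (sumFrom-moment-∷ r₀ r 0 k) (cong₂ _+_ (sumFrom-at r) (sumFrom-moment r))))
            (sym (*-identityˡ _))
...   | inj₂ refl with refl ← trans m≡ (Mr+1-≥ {r = r₀ ∷ r} ≤-refl) = begin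
    sum r + weight r + (r₀ + sum r ∸ sumFrom (at (r₀ ∷ r)) 0 (suc k))
      ≡⟨ cong (_+_ (sum r + weight r))
              (trans (cong (r₀ + sum r ∸_) (sumFrom-at (r₀ ∷ r))) (n∸n≡0 (r₀ + sum r))) ⟩
    sum r + weight r + 0
      ≡⟨ cong (_+ 0) (sym (sumFrom-moment (r₀ ∷ r))) ⟩
    sumFrom (moment (r₀ ∷ r)) 0 (suc k) + 0 ∎
  where open ≡-Reasoning

L-identity : ∀ (A B m θ D : ℤ) →
  (A ℤ.- B ℤ.+ (m ℤ.- + 1) ℤ.* θ ℤ.- D ℤ.+ + 1) ℤ.+ (B ℤ.+ D) ℤ.+ θ ≡ A ℤ.+ m ℤ.* θ ℤ.+ + 1
L-identity = ℤ-Ring.solve-∀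

L-weightSpread : ∀ {k h n} {r : Vec ℕ k} → Positive r → h ≤ sum r → + n ≡ L r h →
  n + weight (packLeft r h) ≡ suc (weight (packRight r h))
L-weightSpread {k} {h} {n} {r} pos h≤Σr n≡L =
  +-cancelʳ-≡ θ (n + weight (packLeft r h)) (suc wmax) (ℤₚ.+-injective (begin
    + (n + weight (packLeft r h) + θ)  ≡⟨ cong (λ w → + (n + w + θ)) (packLeft-weight r h≤Σr I refl) ⟩
    + n ℤ.+ (+ B ℤ.+ + D) ℤ.+ + θ      ≡⟨ cong (λ z → z ℤ.+ (+ B ℤ.+ + D) ℤ.+ + θ) n≡L ⟩
    L r h ℤ.+ (+ B ℤ.+ + D) ℤ.+ + θ    ≡⟨ L-identity (+ A) (+ B) (+ m) (+ θ) (+ D) ⟩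
    + A ℤ.+ + m ℤ.* + θ ℤ.+ + 1        ≡⟨ cong (λ z → + A ℤ.+ z ℤ.+ + 1) (sym (ℤₚ.pos-* m θ)) ⟩
    + (A + m * θ + 1)                  ≡⟨ cong (λ w → + (w + 1)) (sym (packRight-weight r pos h≤Σr m refl)) ⟩
    + (wmax + θ + 1)                   ≡⟨ cong +_ (+-comm (wmax + θ) 1) ⟩
    + (suc wmax + θ)                   ∎))
  where
  open ≡-Reasoning
  I = Ir r h
  m = Mr+1 r h
  θ = θr r h
  A = sumRange (moment r) m k
  B = sumRange (moment r) 0 I
  D = I * δr r h
  wmax = weight (packRight r h)

lemma3 : (k : ℕ) → 1 ≤ k → (r : Vec ℕ k) → (∀ (i : Fin k) → 1 ≤ lookup r i)
    → (h : ℕ) → 1 ≤ h → h ≤ sum r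
    → (t : ℕ) → (P P′ : ℕ → Vec ℕ k)
    → IsPath r h t P → IsPath r h t P′
    → P 1 ≡ P′ 1 → P t ≡ P′ t
    → Σ ℕ (λ i → 1 ≤ i × i ≤ t × P i ≢ P′ i)
    → (a : Vec ℤ k) → (∀ (i j : Fin k) → i Fin.< j → lookup a i ℤ.< lookup a j)
    → Σ ℕ (λ n → (+ n ≡ L r h) × HasCard (InSumset r h a) n)
    → ∀ i → 2 ≤ i → i < t → φ a (P i) ≡ φ a (P′ i)
lemma3 _ _ r pos h _ h≤Σr _ P P′ P-path P′-path P₁≡P′₁ _ _ a inc (n , n≡L , sumset)
       (suc i) (s≤s _) i+1<t =
  equalWeight⇒equalφ {r = r} {P (suc i)} {P′ (suc i)} {a} pos inc
    (L-weightSpread {r = r} pos h≤Σr n≡L) sumset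
    (proj₁ P-path (suc i) (s≤s z≤n) (<⇒≤ i+1<t)) (proj₁ P′-path (suc i) (s≤s z≤n) (<⇒≤ i+1<t))
    (IsPath-sameStart⇒sameWeight {P = P} {P′} {r} P-path P′-path P₁≡P′₁ i (<⇒≤ i+1<t))
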